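{- Let $P\subset\mathbb{R}^2$ be a finite point set with distinct $x$-coordinates and distinct $y$-coordinates, and let $a,b,c\in P$ with $a,b\in F_L(P,c)$, $b.x<a.x$ and $b.y>a.y$. Then either $P$ has no point in the region $[b.x,a.x]\times[c.y,\infty)$, or the point $d$ of $P$ with lowest $y$-coordinate in that region is the first entry of some z-rectangle $(d,q,r,s)$ of $P$.
   Context: For a point $p$, $p.x,p.y$ are its coordinates. $\mathrm{rect}(p,q)$ is the smallest closed axis-aligned rectangle containing $p,q$. The left funnel of $c\in P$ is $F_L(P,c)=\{q\in P: q.y<c.y,\ q.x<c.x,\ P\cap\mathrm{rect}(c,q)=\{c,q\}\}$. A z-rectangle of $P$ is a tuple $(p,q,r,s)\in P^4$ with $q.x<p.x<r.x<s.x$, $r.y<q.y<s.y<p.y$, and $P\cap([q.x,s.x]\times[r.y,p.y])=\{p,q,r,s\}$.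
   Formalization: The points of P have rational coordinates rather than real ones. -}

module Defs where

open import Data.Rational using (ℚ; _<_; _≤_; _⊓_; _⊔_)
open import Data.List using (List)
open import Data.List.Membership.Propositional using (_∈_)
open import Data.Product using (_×_; ∃-syntax)
open import Data.Sum using (_⊎_)
open import Relation.Binary.PropositionalEquality using (_≡_)

-- A point of the plane; coordinates are rationals (only the order of
-- coordinates matters for every notion below).
record Point : Set where
  constructor mkPoint
  field
    x : ℚ
    y : ℚ
open Point public

PointSet : Set
PointSet = List Point

DistinctCoords : PointSet → Set
DistinctCoords P =
  (∀ {p q} → p ∈ P → q ∈ P → x p ≡ x q → p ≡ q) ×
  (∀ {p q} → p ∈ P → q ∈ P → y p ≡ y q → p ≡ q)

InRect : Point → Point → Point → Set
InRect p q z =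
  ((x p ⊓ x q) ≤ x z × x z ≤ (x p ⊔ x q)) ×
  ((y p ⊓ y q) ≤ y z × y z ≤ (y p ⊔ y q))

InLeftFunnel : PointSet → Point → Point → Set
InLeftFunnel P c q =
  q ∈ P × y q < y c × x q < x c ×
  -- P ∩ rect(c,q) = {c,q}  (both inclusions; c ∈ P is assumed separately)
  (∀ z → z ∈ P → InRect c q z → z ≡ c ⊎ z ≡ q) ×
  (∀ z → (z ≡ c ⊎ z ≡ q) → InRect c q z)

InBox : ℚ → ℚ → ℚ → ℚ → Point → Set
InBox x1 x2 y1 y2 z = (x1 ≤ x z × x z ≤ x2) × (y1 ≤ y z × y z ≤ y2)

ZRect : PointSet → Point → Point → Point → Point → Set
ZRect P p q r s =
  (p ∈ P × q ∈ P × r ∈ P × s ∈ P) ×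
  (x q < x p × x p < x r × x r < x s) ×
  (y r < y q × y q < y s × y s < y p) ×
  (∀ z → z ∈ P → InBox (x q) (x s) (y r) (y p) z →
         z ≡ p ⊎ z ≡ q ⊎ z ≡ r ⊎ z ≡ s) ×
  (∀ z → (z ≡ p ⊎ z ≡ q ⊎ z ≡ r ⊎ z ≡ s) → InBox (x q) (x s) (y r) (y p) z)

InRegion : Point → Point → Point → Point → Set
InRegion a b c z = (x b ≤ x z × x z ≤ x a) × y c ≤ y z

{-# OPTIONS --safe #-}
-- Let r be the highest point of P below d with x-coordinate in (d.x, a.x], q the
-- rightmost point in [b.x, d.x) × (r.y, d.y), and s the leftmost point in
-- (a.x, c.x] × [c.y, d.y); the candidates a, b, c show that all three exist.
-- Minimality of d together with the emptiness of rect(c,b) leaves no point in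
-- [b.x, a.x] × (b.y, d.y), so q.y ≤ b.y < c.y ≤ s.y.  A point z of P in the box
-- [q.x, s.x] × [r.y, d.y] is then d, or q, r, s by the extremal choice of these
-- (according as z.x < d.x, d.x < z.x ≤ a.x, or a.x < z.x with z.y ≥ c.y); the
-- remaining case a.x < z.x, z.y < c.y puts z inside rect(c,a).
module Submission where

open import Defs
open import Data.Rational using (ℚ; _<_; _≤_; _≤?_; _<?_; _≟_)
open import Data.Rational.Properties
  using (≤-decTotalOrder; <-cmp; <⇒≤; <-irrefl; <-trans; ≤-<-trans; <-≤-trans;
         ≤-refl; ≤-trans; ≤-antisym; ≰⇒>; ≮⇒≥; p⊓q≤q; p≤p⊔q)
open import Relation.Binary.Bundles using (DecTotalOrder)
open import Data.List using (List; filter)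
open import Data.List.Membership.Propositional using (_∈_)
open import Data.List.Membership.Propositional.Properties using (∈-filter⁺; ∈-filter⁻)
open import Data.List.Relation.Unary.All using (lookup; tabulate)
open import Data.List.Extrema (DecTotalOrder.totalOrder ≤-decTotalOrder)
  using (argmax; argmin; argmax-all; argmin-all; f[xs]≤f[argmax]; f[argmin]≤f[xs])
open import Data.Product using (_×_; ∃; ∃-syntax; _,_; proj₁; proj₂)
open import Data.Sum using (_⊎_; inj₁; inj₂; [_,_]′)
open import Function using (_∘_)
open import Data.Empty using (⊥; ⊥-elim)
open import Relation.Nullary using (¬_; yes; no; contradiction)
open import Relation.Nullary.Decidable using (_×-dec_)
open import Relation.Unary using (Decidable)
open import Relation.Binary.PropositionalEquality using (_≡_; _≢_; refl; cong; ≢-sym)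
open import Relation.Binary.Definitions using (tri<; tri≈; tri>)

private
  variable
    A : Set
    p q r s z : Point

Greatest : (A → ℚ) → (A → Set) → List A → A → Set
Greatest f S xs m = m ∈ xs × S m × (∀ {z} → z ∈ xs → S z → f z ≤ f m)

Least : (A → ℚ) → (A → Set) → List A → A → Set
Least f S xs m = m ∈ xs × S m × (∀ {z} → z ∈ xs → S z → f m ≤ f z)

greatest-exists : {S : A → Set} → Decidable S → (f : A → ℚ) →
                  ∀ {w xs} → w ∈ xs → S w → ∃ (Greatest f S xs)
greatest-exists {A = A} {S = S} S? f {w} {xs} w∈xs Sw =
  m , proj₁ m∈xs×Sm , proj₂ m∈xs×Sm ,
  λ z∈xs Sz → lookup (f[xs]≤f[argmax] w (filter S? xs)) (∈-filter⁺ S? z∈xs Sz)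
  where
  m : A
  m = argmax f w (filter S? xs)
  m∈xs×Sm : m ∈ xs × S m
  m∈xs×Sm = argmax-all f (w∈xs , Sw) (tabulate (∈-filter⁻ S?))

least-exists : {S : A → Set} → Decidable S → (f : A → ℚ) →
               ∀ {w xs} → w ∈ xs → S w → ∃ (Least f S xs)
least-exists {A = A} {S = S} S? f {w} {xs} w∈xs Sw =
  m , proj₁ m∈xs×Sm , proj₂ m∈xs×Sm ,
  λ z∈xs Sz → lookup (f[argmin]≤f[xs] w (filter S? xs)) (∈-filter⁺ S? z∈xs Sz)
  where
  m : A
  m = argmin f w (filter S? xs)
  m∈xs×Sm : m ∈ xs × S m
  m∈xs×Sm = argmin-all f (w∈xs , Sw) (tabulate (∈-filter⁻ S?))

≤∧≢⇒< : ∀ {u v : ℚ} → u ≤ v → u ≢ v → u < v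
≤∧≢⇒< {u} {v} u≤v u≢v with <-cmp u v
... | tri< u<v _ _ = u<v
... | tri≈ _ u≡v _ = contradiction u≡v u≢v
... | tri> _ _ v<u = ⊥-elim (<-irrefl refl (≤-<-trans u≤v v<u))

x-<⇒≢ : x p < x q → p ≢ q
x-<⇒≢ xp<xq refl = <-irrefl refl xp<xq

y-<⇒≢ : y p < y q → p ≢ q
y-<⇒≢ yp<yq refl = <-irrefl refl yp<yq

inRect⁺ : x q ≤ x z → x z ≤ x p → y q ≤ y z → y z ≤ y p → InRect p q z
inRect⁺ {q} {z} {p} qz zp qz′ zp′ =
  (≤-trans (p⊓q≤q (x p) (x q)) qz , ≤-trans zp (p≤p⊔q (x p) (x q))) ,
  (≤-trans (p⊓q≤q (y p) (y q)) qz′ , ≤-trans zp′ (p≤p⊔q (y p) (y q)))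

leftFunnel-rect-empty : ∀ {P c} → InLeftFunnel P c q → z ∈ P →
  x q ≤ x z → x z ≤ x c → y q ≤ y z → y z ≤ y c → z ≢ c → z ≢ q → ⊥
leftFunnel-rect-empty (_ , _ , _ , only-c-q , _) z∈P qz zc qz′ zc′ z≢c z≢q =
  [ z≢c , z≢q ]′ (only-c-q _ z∈P (inRect⁺ qz zc qz′ zc′))

zShape-inBox : x q < x p × x p < x r × x r < x s → y r < y q × y q < y s × y s < y p →
  ∀ z → z ≡ p ⊎ z ≡ q ⊎ z ≡ r ⊎ z ≡ s → InBox (x q) (x s) (y r) (y p) z
zShape-inBox (qp , pr , rs) (rq , qs , sp) _ (inj₁ refl) =
  (<⇒≤ qp , <⇒≤ (<-trans pr rs)) , (<⇒≤ (<-trans rq (<-trans qs sp)) , ≤-refl)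
zShape-inBox (qp , pr , rs) (rq , qs , sp) _ (inj₂ (inj₁ refl)) =
  (≤-refl , <⇒≤ (<-trans qp (<-trans pr rs))) , (<⇒≤ rq , <⇒≤ (<-trans qs sp))
zShape-inBox (qp , pr , rs) (rq , qs , sp) _ (inj₂ (inj₂ (inj₁ refl))) =
  (<⇒≤ (<-trans qp pr) , <⇒≤ rs) , (≤-refl , <⇒≤ (<-trans rq (<-trans qs sp)))
zShape-inBox (qp , pr , rs) (rq , qs , sp) _ (inj₂ (inj₂ (inj₂ refl))) =
  (<⇒≤ (<-trans qp (<-trans pr rs)) , ≤-refl) , (<⇒≤ (<-trans rq qs) , <⇒≤ sp)

module LowestInRegion
  {P : PointSet} (distinct : DistinctCoords P)
  {a b c : Point} (c∈P : c ∈ P) (a∈F : InLeftFunnel P c a) (b∈F : InLeftFunnel P c b)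
  {d : Point} (d∈P : d ∈ P) (d∈R : InRegion a b c d)
  (d-lowest : ∀ z → z ∈ P → InRegion a b c z → y d ≤ y z)
  where

  same-x : z ∈ P → p ∈ P → x z ≡ x p → z ≡ p
  same-x = proj₁ distinct

  same-y : z ∈ P → p ∈ P → y z ≡ y p → z ≡ p
  same-y = proj₂ distinct

  <-by-x : z ∈ P → p ∈ P → x z ≤ x p → z ≢ p → x z < x p
  <-by-x z∈P p∈P xz≤xp z≢p = ≤∧≢⇒< xz≤xp (z≢p ∘ same-x z∈P p∈P)

  <-by-y : z ∈ P → p ∈ P → y z ≤ y p → z ≢ p → y z < y p
  <-by-y z∈P p∈P yz≤yp z≢p = ≤∧≢⇒< yz≤yp (z≢p ∘ same-y z∈P p∈P)

  a∈P : a ∈ P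
  a∈P = proj₁ a∈F

  b∈P : b ∈ P
  b∈P = proj₁ b∈F

  ax<cx : x a < x c
  ax<cx = proj₁ (proj₂ (proj₂ a∈F))

  cy≤dy : y c ≤ y d
  cy≤dy = proj₂ d∈R

  ay<dy : y a < y d
  ay<dy = <-≤-trans (proj₁ (proj₂ a∈F)) cy≤dy

  by<cy : y b < y c
  by<cy = proj₁ (proj₂ b∈F)

  dx<ax : x d < x a
  dx<ax = <-by-x d∈P a∈P (proj₂ (proj₁ d∈R)) (≢-sym (y-<⇒≢ ay<dy))

  bx<dx : x b < x d
  bx<dx = <-by-x b∈P d∈P (proj₁ (proj₁ d∈R)) (y-<⇒≢ (<-≤-trans by<cy cy≤dy))

  cy<dy : y c < y d
  cy<dy = <-by-y c∈P d∈P cy≤dy (≢-sym (x-<⇒≢ (<-trans dx<ax ax<cx)))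

  -- Below c.y this is rect(c,b); above c.y it would contradict the choice of d.
  strip-empty : z ∈ P → x b ≤ x z → x z ≤ x a → y b < y z → y z < y d → ⊥
  strip-empty {z} z∈P bz za bz′ zd with y z ≤? y c
  ... | yes zc = leftFunnel-rect-empty b∈F z∈P bz (≤-trans za (<⇒≤ ax<cx)) (<⇒≤ bz′) zc
                   (x-<⇒≢ (≤-<-trans za ax<cx)) (≢-sym (y-<⇒≢ bz′))
  ... | no zc = <-irrefl refl (≤-<-trans (d-lowest _ z∈P ((bz , za) , <⇒≤ (≰⇒> zc))) zd)

  ≤-by-strip : z ∈ P → x b ≤ x z → x z ≤ x a → y z < y d → y z ≤ y b
  ≤-by-strip z∈P bz za zd = ≮⇒≥ (λ bz′ → strip-empty z∈P bz za bz′ zd)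

  LowerRight : Point → Set
  LowerRight z = (x d < x z × x z ≤ x a) × y z < y d

  LowerLeft : Point → Point → Set
  LowerLeft r z = (x b ≤ x z × x z < x d) × (y r < y z × y z < y d)

  FarRight : Point → Set
  FarRight z = (x a < x z × x z ≤ x c) × (y c ≤ y z × y z < y d)

  lowerRight? : Decidable LowerRight
  lowerRight? z = (x d <? x z ×-dec x z ≤? x a) ×-dec y z <? y d

  lowerLeft? : ∀ r → Decidable (LowerLeft r)
  lowerLeft? r z = (x b ≤? x z ×-dec x z <? x d) ×-dec (y r <? y z ×-dec y z <? y d)

  farRight? : Decidable FarRight
  farRight? z = (x a <? x z ×-dec x z ≤? x c) ×-dec (y c ≤? y z ×-dec y z <? y d)

  lowerRight-a : LowerRight a
  lowerRight-a = (dx<ax , ≤-refl) , ay<dy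

  lowerLeft-b : Greatest y LowerRight P r → LowerLeft r b
  lowerLeft-b {r} (r∈P , ((dx<rx , rx≤ax) , ry<dy) , _) =
    (≤-refl , bx<dx) , (ry<by , <-≤-trans by<cy cy≤dy)
    where
    bx<rx : x b < x r
    bx<rx = <-trans bx<dx dx<rx
    ry<by : y r < y b
    ry<by = <-by-y r∈P b∈P (≤-by-strip r∈P (<⇒≤ bx<rx) rx≤ax ry<dy) (≢-sym (x-<⇒≢ bx<rx))

  farRight-c : FarRight c
  farRight-c = (ax<cx , ≤-refl) , (≤-refl , cy<dy)

  zRect : Greatest y LowerRight P r → Greatest x (LowerLeft r) P q → Least x FarRight P s →
          ZRect P d q r s
  zRect {r} {q} {s}
        (r∈P , ((dx<rx , rx≤ax) , ry<dy) , r-top)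
        (q∈P , ((bx≤qx , qx<dx) , (ry<qy , qy<dy)) , q-right)
        (s∈P , ((ax<sx , sx≤cx) , (cy≤sy , sy<dy)) , s-left) =
    (d∈P , q∈P , r∈P , s∈P) , x-order , y-order , box-points , zShape-inBox x-order y-order
    where
    x-order : x q < x d × x d < x r × x r < x s
    x-order = qx<dx , dx<rx , ≤-<-trans rx≤ax ax<sx

    qy≤by : y q ≤ y b
    qy≤by = ≤-by-strip q∈P bx≤qx (<⇒≤ (<-trans qx<dx dx<ax)) qy<dy

    y-order : y r < y q × y q < y s × y s < y d
    y-order = ry<qy , ≤-<-trans qy≤by (<-≤-trans by<cy cy≤sy) , sy<dy

    left-of-d : z ∈ P → x q ≤ x z → x z < x d → y r ≤ y z → y z < y d → z ≡ q
    left-of-d {z} z∈P qz zd rz zd′ =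
      same-x z∈P q∈P (≤-antisym (q-right z∈P ((≤-trans bx≤qx qz , zd) , ry<zy , zd′)) qz)
      where
      ry<zy : y r < y z
      ry<zy = <-by-y r∈P z∈P rz (≢-sym (x-<⇒≢ (<-trans zd dx<rx)))

    right-of-d : z ∈ P → x d < x z → x z ≤ x a → y r ≤ y z → y z < y d → z ≡ r
    right-of-d z∈P dz za rz zd = same-y z∈P r∈P (≤-antisym (r-top z∈P ((dz , za) , zd)) rz)

    right-of-a : z ∈ P → x a < x z → x z ≤ x s → y r ≤ y z → y z < y d → z ≡ s
    right-of-a {z} z∈P az zs rz zd with y c ≤? y z
    ... | yes cz = same-x z∈P s∈P (≤-antisym zs (s-left z∈P ((az , ≤-trans zs sx≤cx) , (cz , zd))))
    ... | no cz = ⊥-elim (leftFunnel-rect-empty a∈F z∈P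
                    (<⇒≤ az) (≤-trans zs sx≤cx) (≤-trans (r-top a∈P lowerRight-a) rz) (<⇒≤ zy<cy)
                    (y-<⇒≢ zy<cy) (≢-sym (x-<⇒≢ az)))
      where
      zy<cy : y z < y c
      zy<cy = ≰⇒> cz

    box-points : ∀ z → z ∈ P → InBox (x q) (x s) (y r) (y d) z →
                 z ≡ d ⊎ z ≡ q ⊎ z ≡ r ⊎ z ≡ s
    box-points z z∈P ((qz , zs) , (rz , zd)) with y z ≟ y d | <-cmp (x z) (x d) | x z ≤? x a
    ... | yes zy≡dy | _ | _ = inj₁ (same-y z∈P d∈P zy≡dy)
    ... | no zy≢dy | tri≈ _ zx≡dx _ | _ = contradiction (cong y (same-x z∈P d∈P zx≡dx)) zy≢dy
    ... | no zy≢dy | tri< zx<dx _ _ | _ =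
      inj₂ (inj₁ (left-of-d z∈P qz zx<dx rz (≤∧≢⇒< zd zy≢dy)))
    ... | no zy≢dy | tri> _ _ dx<zx | yes za =
      inj₂ (inj₂ (inj₁ (right-of-d z∈P dx<zx za rz (≤∧≢⇒< zd zy≢dy))))
    ... | no zy≢dy | tri> _ _ dx<zx | no za =
      inj₂ (inj₂ (inj₂ (right-of-a z∈P (≰⇒> za) zs rz (≤∧≢⇒< zd zy≢dy))))

  zRect-exists : ∃[ q ] ∃[ r ] ∃[ s ] ZRect P d q r s
  zRect-exists =
    let r , r-top = greatest-exists lowerRight? y a∈P lowerRight-a
        q , q-right = greatest-exists (lowerLeft? r) x b∈P (lowerLeft-b r-top)
        s , s-left = least-exists farRight? x c∈P farRight-c
    in q , r , s , zRect r-top q-right s-left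

lemma31 : (P : PointSet) → DistinctCoords P →
    (a b c : Point) → a ∈ P → b ∈ P → c ∈ P →
    InLeftFunnel P c a → InLeftFunnel P c b →
    x b < x a → y a < y b →
    (∀ z → z ∈ P → ¬ InRegion a b c z) ⊎
    (∀ d → d ∈ P → InRegion a b c d →
       (∀ z → z ∈ P → InRegion a b c z → y d ≤ y z) →
       ∃[ q ] ∃[ r ] ∃[ s ] ZRect P d q r s)
-- The hypotheses b.x < a.x and a.y < b.y are redundant: the first follows from the
-- existence of d, the second from a.y ≤ r.y < b.y.
lemma31 P distinct a b c _ _ c∈P a∈F b∈F _ _ =
  inj₂ λ d d∈P d∈R d-lowest → LowestInRegion.zRect-exists distinct c∈P a∈F b∈F d∈P d∈R d-lowest
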